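{- Let $p$ be a prime, $m\geq1$ and $n\ge1$ integers, $\mathbf{X}\in\mathbb{Z}^{n\times n}$ and $b\in\mathbb{Z}^n$ with $b\not\equiv0\bmod p$. For $1\le t\le n$ define $$U_t:=\sup\{j\geq0:\ \mathbf{X}^{t-1}b\in\operatorname{span}_{\mathbb{Z}}(\mathbf{X}^{i-1}b:1\leq i\leq t-1)+p^j\mathbb{Z}^n\}$$ and $\Lambda_t:=\min\{U_t,m\}$. Let $\mathbf{W}$ be the $n\times n$ matrix with columns $b,\mathbf{X}b,\ldots,\mathbf{X}^{n-1}b$. Then, as Abelian groups, $\operatorname{coker}(\mathbf{W})_{p^m}\cong\bigoplus_{t=1}^n\mathbb{Z}/p^{\Lambda_t}\mathbb{Z}$.
   Context: $\operatorname{span}_{\mathbb{Z}}(v_1,\ldots,v_t)$ is the set of integer linear combinations (the empty span is $\{0\}$). $\operatorname{coker}(\mathbf{W}):=\mathbb{Z}^n/\mathbf{W}(\mathbb{Z}^n)$, and for an Abelian group $H$, $H_{p^m}:=H/p^mH$. -}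

module Defs where

open import Data.Nat as ℕ using (ℕ; zero; suc)
open import Data.Integer using (ℤ; +_; _+_; _*_; _-_; 0ℤ)
open import Data.Integer.Divisibility using (_∣_)
open import Data.Fin using (Fin; toℕ)
open import Data.Product using (Σ; ∃; _×_)
open import Relation.Binary.PropositionalEquality using (_≡_)

Vecℤ : ℕ → Set
Vecℤ n = Fin n → ℤ

Matℤ : ℕ → Set
Matℤ n = Fin n → Fin n → ℤ

sumF : ∀ {n} → (Fin n → ℤ) → ℤ
sumF {zero}  f = 0ℤ
sumF {suc n} f = f Fin.zero + sumF (λ i → f (Fin.suc i))

_·_ : ∀ {n} → Matℤ n → Vecℤ n → Vecℤ n
(A · v) r = sumF (λ k → A r k * v k)

powApp : ∀ {n} → Matℤ n → ℕ → Vecℤ n → Vecℤ n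
powApp X zero    b = b
powApp X (suc k) b = X · powApp X k b

-- Membership (for 0-based index t, i.e. paper's t = toℕ t + 1):
-- X^{t} b ∈ span_ℤ(X^i b : i < t) + p^j ℤ^n
InSpanMod : ∀ {n} (p : ℕ) (X : Matℤ n) (b : Vecℤ n) (t : Fin n) (j : ℕ) → Set
InSpanMod {n} p X b t j =
  Σ (Fin (toℕ t) → ℤ) λ c → Σ (Vecℤ n) λ y →
    ∀ r → powApp X (toℕ t) b r
          ≡ sumF (λ i → c i * powApp X (toℕ i) b r) + (+ (p ℕ.^ j)) * y r

-- Λ t = min{U_t, m}, where U_t = sup{j ≥ 0 : InSpanMod … t j}:
-- Λ t is the largest j ≤ m satisfying the membership condition.
IsLambda : ∀ {n} (p m : ℕ) (X : Matℤ n) (b : Vecℤ n) (Λ : Fin n → ℕ) → Set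
IsLambda p m X b Λ = ∀ t →
  (Λ t ℕ.≤ m) × InSpanMod p X b t (Λ t)
  × (∀ j → j ℕ.≤ m → InSpanMod p X b t j → j ℕ.≤ Λ t)

Wmat : ∀ {n} → Matℤ n → Vecℤ n → Matℤ n
Wmat X b r c = powApp X (toℕ c) b r

-- Equality in coker(W)_{p^m} = ℤ^n / (W ℤ^n + p^m ℤ^n), as a relation on ℤ^n.
CokerEq : ∀ {n} (p m : ℕ) (W : Matℤ n) → Vecℤ n → Vecℤ n → Set
CokerEq {n} p m W x y =
  Σ (Vecℤ n) λ v → Σ (Vecℤ n) λ w →
    ∀ r → x r - y r ≡ (W · v) r + (+ (p ℕ.^ m)) * w r

-- Equality in ⊕_t ℤ/p^{Λ t}ℤ, as a relation on ℤ^n.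
SumEq : ∀ {n} (p : ℕ) (Λ : Fin n → ℕ) → Vecℤ n → Vecℤ n → Set
SumEq p Λ x y = ∀ t → (+ (p ℕ.^ Λ t)) ∣ (x t - y t)

_⊕_ : ∀ {n} → Vecℤ n → Vecℤ n → Vecℤ n
(x ⊕ y) r = x r + y r

-- Abelian group isomorphism between the two quotients, given by a map on
-- representatives: well-defined, additive, injective, surjective.
GroupIso : ∀ {n} → (Vecℤ n → Vecℤ n → Set) → (Vecℤ n → Vecℤ n → Set) → Set
GroupIso {n} _≈₁_ _≈₂_ =
  Σ (Vecℤ n → Vecℤ n) λ f →
    (∀ x y → x ≈₁ y → f x ≈₂ f y)
    × (∀ x y → f (x ⊕ y) ≈₂ (f x ⊕ f y))
    × (∀ x y → f x ≈₂ f y → x ≈₁ y)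
    × (∀ z → Σ (Vecℤ n) λ x → f x ≈₂ z)

-- Write X^t b = Σ_{i<t} c_i X^i b + p^Λ_t y_t. Modulo p^m the vectors p^Λ_t y_t span the same
-- submodule as the columns X^i b of W, since the relations are triangular. Maximality of Λ_t
-- says that when Λ_t < m, y_t is not congruent modulo p to a combination of y_0, …, y_{t-1}.
-- Gaussian elimination over ℤ/p^m, whose pivots are prime to p and hence units, therefore
-- gives an automorphism of (ℤ/p^m)^n sending each such y_t to the unit vector e_t. It maps
-- Wℤ^n + p^m ℤ^n onto ⊕_t p^Λ_t ℤ (when Λ_t = m, p^Λ_t y_t vanishes modulo p^m anyway), and the
-- quotient of ℤ^n by the latter is ⊕_t ℤ/p^Λ_t ℤ.

module Submission where

open import Defs
open import Data.Nat using (ℕ; _≥_)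
open import Data.Nat.Primality using (Prime)
open import Data.Integer using (+_)
open import Data.Integer.Divisibility using (_∣_)
open import Data.Fin using (Fin)
open import Relation.Nullary using (¬_)

open import Data.Empty using (⊥-elim)
open import Data.Fin as F using (toℕ)
open import Data.Fin.Properties using (any?; toℕ-fromℕ<; toℕ<n; toℕ-injective; <⇒≢)
open import Data.Integer as ℤ using (ℤ; -[1+_]; _+_; _*_; _-_; -_; 0ℤ; 1ℤ)
open import Data.Integer.Divisibility.Signed
  using (divides; ∣m+n∣m⇒∣n; ∣⇒∣ᵤ; ∣ᵤ⇒∣) renaming (_∣_ to _∣ₛ_; _∣?_ to _∣ₛ?_)
import Data.Integer.Properties as ℤ
open import Algebra.Properties.Semiring.Sum ℤ.+-*-semiring using (sum; ∑-distrib-+; *-distribˡ-sum)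
open import Data.Integer.Tactic.RingSolver using (solve-∀)
open import Data.Nat as ℕ using (zero; suc)
open import Data.Nat.Coprimality using (Coprime; coprime-divisor; coprime-Bézout)
open import Data.Nat.Divisibility using (∣-trans; ∣1⇒≡1)
open import Data.Nat.GCD using (module Bézout)
open import Data.Nat.Induction using (<-rec)
open import Data.Nat.Primality using (prime⇒irreducible)
import Data.Nat.Properties as ℕ
open import Data.Product using (Σ; ∃; ∃₂; _×_; _,_; proj₁; proj₂)
open import Data.Sum using (inj₁; inj₂)
open import Function using (_∘_)
open import Relation.Binary.PropositionalEquality
open import Relation.Nullary using (Dec; yes; no; ¬?)
open import Relation.Nullary.Decidable using (_×-dec_; decidable-stable)

-- Finite sums and linear combinations

sumF-cong : ∀ {n} {f g : Fin n → ℤ} → f ≗ g → sumF f ≡ sumF g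
sumF-cong {zero}  f≗g = refl
sumF-cong {suc n} f≗g = cong₂ _+_ (f≗g F.zero) (sumF-cong (f≗g ∘ F.suc))

sumF≡sum : ∀ {n} (f : Fin n → ℤ) → sumF f ≡ sum f
sumF≡sum {zero}  f = refl
sumF≡sum {suc n} f = cong (_+_ (f F.zero)) (sumF≡sum (f ∘ F.suc))

sumF-+ : ∀ {n} (f g : Fin n → ℤ) → sumF (λ i → f i + g i) ≡ sumF f + sumF g
sumF-+ f g = begin
  sumF (λ i → f i + g i)  ≡⟨ sumF≡sum (λ i → f i + g i) ⟩
  sum (λ i → f i + g i)   ≡⟨ ∑-distrib-+ f g ⟩
  sum f + sum g           ≡⟨ cong₂ _+_ (sumF≡sum f) (sumF≡sum g) ⟨
  sumF f + sumF g         ∎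
  where open ≡-Reasoning

*-distribˡ-sumF : ∀ {n} c (f : Fin n → ℤ) → c * sumF f ≡ sumF (λ i → c * f i)
*-distribˡ-sumF c f = begin
  c * sumF f              ≡⟨ cong (c *_) (sumF≡sum f) ⟩
  c * sum f               ≡⟨ *-distribˡ-sum c f ⟩
  sum (λ i → c * f i)     ≡⟨ sumF≡sum (λ i → c * f i) ⟨
  sumF (λ i → c * f i)    ∎
  where open ≡-Reasoning

sumF-zero : ∀ {n} {f : Fin n → ℤ} → (∀ i → f i ≡ 0ℤ) → sumF f ≡ 0ℤ
sumF-zero {zero}  f≡0 = refl
sumF-zero {suc n} f≡0 = cong₂ _+_ (f≡0 F.zero) (sumF-zero (f≡0 ∘ F.suc))

δ : ∀ {n} → Fin n → Fin n → ℤ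
δ F.zero    F.zero    = 1ℤ
δ F.zero    (F.suc j) = 0ℤ
δ (F.suc i) F.zero    = 0ℤ
δ (F.suc i) (F.suc j) = δ i j

δ-diag : ∀ {n} (i : Fin n) → δ i i ≡ 1ℤ
δ-diag F.zero    = refl
δ-diag (F.suc i) = δ-diag i

δ-offdiag : ∀ {n} {i j : Fin n} → i ≢ j → δ i j ≡ 0ℤ
δ-offdiag {i = F.zero}  {F.zero}  i≢j = ⊥-elim (i≢j refl)
δ-offdiag {i = F.zero}  {F.suc j} i≢j = refl
δ-offdiag {i = F.suc i} {F.zero}  i≢j = refl
δ-offdiag {i = F.suc i} {F.suc j} i≢j = δ-offdiag (i≢j ∘ cong F.suc)

sumF-δ : ∀ {n} (a : Fin n → ℤ) (j : Fin n) → sumF (λ i → a i * δ i j) ≡ a j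
sumF-δ {suc n} a F.zero = begin
  a F.zero * 1ℤ + sumF (λ i → a (F.suc i) * 0ℤ)
    ≡⟨ cong₂ _+_ (ℤ.*-identityʳ (a F.zero)) (sumF-zero (λ i → ℤ.*-zeroʳ (a (F.suc i)))) ⟩
  a F.zero + 0ℤ
    ≡⟨ ℤ.+-identityʳ _ ⟩
  a F.zero ∎
  where open ≡-Reasoning
sumF-δ {suc n} a (F.suc j) = begin
  a F.zero * 0ℤ + sumF (λ i → a (F.suc i) * δ i j)
    ≡⟨ cong (_+ sumF (λ i → a (F.suc i) * δ i j)) (ℤ.*-zeroʳ (a F.zero)) ⟩
  0ℤ + sumF (λ i → a (F.suc i) * δ i j)
    ≡⟨ ℤ.+-identityˡ _ ⟩
  sumF (λ i → a (F.suc i) * δ i j)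
    ≡⟨ sumF-δ (a ∘ F.suc) j ⟩
  a (F.suc j) ∎
  where open ≡-Reasoning

0ᵥ : ∀ {n} → Vecℤ n
0ᵥ _ = 0ℤ

e : ∀ {n} → Fin n → Vecℤ n
e = δ

infixl 7 _⊛_
_⊛_ : ∀ {n} → ℤ → Vecℤ n → Vecℤ n
(c ⊛ x) r = c * x r

infixl 6 _⊖_
_⊖_ : ∀ {n} → Vecℤ n → Vecℤ n → Vecℤ n
(x ⊖ y) r = x r - y r

lincomb : ∀ {k n} → (Fin k → ℤ) → (Fin k → Vecℤ n) → Vecℤ n
lincomb a G r = sumF (λ i → a i * G i r)

lincomb-e : ∀ {n} (a : Vecℤ n) → lincomb a e ≗ a
lincomb-e = sumF-δ

module _ {k n : ℕ} (G : Fin k → Vecℤ n) where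

  lincomb-zero : lincomb (λ _ → 0ℤ) G ≗ 0ᵥ
  lincomb-zero r = sumF-zero (λ i → ℤ.*-zeroˡ (G i r))

  lincomb-⊕ : ∀ a b → lincomb (λ i → a i + b i) G ≗ lincomb a G ⊕ lincomb b G
  lincomb-⊕ a b r = trans (sumF-cong (λ i → ℤ.*-distribʳ-+ (G i r) (a i) (b i)))
                          (sumF-+ (λ i → a i * G i r) (λ i → b i * G i r))

  lincomb-⊛ : ∀ c a → lincomb (λ i → c * a i) G ≗ c ⊛ lincomb a G
  lincomb-⊛ c a r = trans (sumF-cong (λ i → ℤ.*-assoc c (a i) (G i r)))
                          (sym (*-distribˡ-sumF c (λ i → a i * G i r)))

  ⊛-lincomb : ∀ c a → c ⊛ lincomb a G ≗ lincomb a (λ i → c ⊛ G i)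
  ⊛-lincomb c a r = trans (*-distribˡ-sumF c (λ i → a i * G i r))
                          (sumF-cong (λ i → lemma c (a i) (G i r)))
    where
    lemma : ∀ c a g → c * (a * g) ≡ a * (c * g)
    lemma = solve-∀

  lincomb-δ : ∀ j → lincomb (λ i → δ i j) G ≗ G j
  lincomb-δ j r = trans (sumF-cong (λ i → ℤ.*-comm (δ i j) (G i r))) (sumF-δ (λ i → G i r) j)

-- Congruences and spans modulo M

infix 4 _≈_[mod_]
record _≈_[mod_] {n : ℕ} (x y : Vecℤ n) (M : ℤ) : Set where
  constructor _,_
  field
    quotient : Vecℤ n
    equality : ∀ r → x r ≡ y r + M * quotient r

module _ {n : ℕ} {M : ℤ} where

  ≈-reflexive : {x y : Vecℤ n} → x ≗ y → x ≈ y [mod M ]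
  ≈-reflexive {y = y} x≗y = 0ᵥ , λ r → trans (x≗y r) (lemma (y r) M)
    where
    lemma : ∀ a M → a ≡ a + M * 0ℤ
    lemma = solve-∀

  ≈-refl : {x : Vecℤ n} → x ≈ x [mod M ]
  ≈-refl = ≈-reflexive (λ _ → refl)

  ≈-sym : {x y : Vecℤ n} → x ≈ y [mod M ] → y ≈ x [mod M ]
  ≈-sym {y = y} (w , eq) = (λ r → - w r) , λ r →
    trans (lemma (y r) M (w r)) (cong (_+ M * - w r) (sym (eq r)))
    where
    lemma : ∀ a M w → a ≡ (a + M * w) + M * (- w)
    lemma = solve-∀

  ≈-trans : {x y z : Vecℤ n} → x ≈ y [mod M ] → y ≈ z [mod M ] → x ≈ z [mod M ]
  ≈-trans {z = z} (w , eq) (w′ , eq′) = (λ r → w′ r + w r) , λ r →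
    trans (eq r) (trans (cong (_+ M * w r) (eq′ r)) (lemma (z r) M (w′ r) (w r)))
    where
    lemma : ∀ a M w′ w → (a + M * w′) + M * w ≡ a + M * (w′ + w)
    lemma = solve-∀

  ≈-⊕ : {x y x′ y′ : Vecℤ n} → x ≈ y [mod M ] → x′ ≈ y′ [mod M ] → x ⊕ x′ ≈ y ⊕ y′ [mod M ]
  ≈-⊕ {y = y} {y′ = y′} (w , eq) (w′ , eq′) = (λ r → w r + w′ r) , λ r →
    trans (cong₂ _+_ (eq r) (eq′ r)) (lemma (y r) (y′ r) M (w r) (w′ r))
    where
    lemma : ∀ a b M w w′ → (a + M * w) + (b + M * w′) ≡ (a + b) + M * (w + w′)
    lemma = solve-∀

  ≈-⊛ : ∀ c {x y : Vecℤ n} → x ≈ y [mod M ] → c ⊛ x ≈ c ⊛ y [mod M ]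
  ≈-⊛ c {y = y} (w , eq) = (λ r → c * w r) , λ r →
    trans (cong (c *_) (eq r)) (lemma c (y r) M (w r))
    where
    lemma : ∀ c a M w → c * (a + M * w) ≡ c * a + M * (c * w)
    lemma = solve-∀

  ⊛-≈-0 : (w : Vecℤ n) → M ⊛ w ≈ 0ᵥ [mod M ]
  ⊛-≈-0 w = w , λ r → sym (ℤ.+-identityˡ (M * w r))

  ≈-weaken : ∀ {N} {x y : Vecℤ n} → M ∣ₛ N → x ≈ y [mod N ] → x ≈ y [mod M ]
  ≈-weaken {N} {y = y} (divides d N≡dM) (w , eq) = (λ r → d * w r) , λ r →
    trans (eq r) (trans (cong (λ z → y r + z * w r) N≡dM) (lemma (y r) d M (w r)))
    where
    lemma : ∀ a d M w → a + (d * M) * w ≡ a + M * (d * w)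
    lemma = solve-∀

  ≈-⊛-mod : ∀ c {x y : Vecℤ n} → x ≈ y [mod M ] → c ⊛ x ≈ c ⊛ y [mod c * M ]
  ≈-⊛-mod c {y = y} (w , eq) = w , λ r →
    trans (cong (c *_) (eq r)) (lemma c (y r) M (w r))
    where
    lemma : ∀ c a M w → c * (a + M * w) ≡ c * a + (c * M) * w
    lemma = solve-∀

pointwise-≈ : ∀ {n M} {x y : Vecℤ n} → (∀ r → ∃ λ q → x r ≡ y r + M * q) → x ≈ y [mod M ]
pointwise-≈ x≈y = proj₁ ∘ x≈y , proj₂ ∘ x≈y

zero-⊛ : ∀ {n c} → c ≡ 0ℤ → (x y : Vecℤ n) → c ⊛ x ≗ c ⊛ y
zero-⊛ refl x y r = trans (ℤ.*-zeroˡ (x r)) (sym (ℤ.*-zeroˡ (y r)))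

multiple-≈ : ∀ {n c M} → c ≡ M → (x y : Vecℤ n) → c ⊛ x ≈ c ⊛ y [mod M ]
multiple-≈ refl x y = ≈-trans (⊛-≈-0 x) (≈-sym (⊛-≈-0 y))

lincomb-≈ : ∀ {k n M} (a : Fin k → ℤ) {G H : Fin k → Vecℤ n} →
            (∀ i → a i ⊛ G i ≈ a i ⊛ H i [mod M ]) → lincomb a G ≈ lincomb a H [mod M ]
lincomb-≈ {zero}  a aG≈aH = ≈-refl
lincomb-≈ {suc k} a aG≈aH = ≈-⊕ (aG≈aH F.zero) (lincomb-≈ (a ∘ F.suc) (aG≈aH ∘ F.suc))

infix 4 _∈⟨_⟩[mod_]
record _∈⟨_⟩[mod_] {k n : ℕ} (x : Vecℤ n) (G : Fin k → Vecℤ n) (M : ℤ) : Set where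
  constructor _,_
  field
    coefficients : Fin k → ℤ
    congruence   : x ≈ lincomb coefficients G [mod M ]

module _ {k n : ℕ} {M : ℤ} {G : Fin k → Vecℤ n} where

  ∈-resp-≈ : {x y : Vecℤ n} → x ≈ y [mod M ] → y ∈⟨ G ⟩[mod M ] → x ∈⟨ G ⟩[mod M ]
  ∈-resp-≈ x≈y (a , y≈aG) = a , ≈-trans x≈y y≈aG

  ∈-resp-≗ : {x y : Vecℤ n} → x ≗ y → y ∈⟨ G ⟩[mod M ] → x ∈⟨ G ⟩[mod M ]
  ∈-resp-≗ x≗y = ∈-resp-≈ (≈-reflexive x≗y)

  0ᵥ-∈ : 0ᵥ ∈⟨ G ⟩[mod M ]
  0ᵥ-∈ = (λ _ → 0ℤ) , ≈-reflexive (λ r → sym (lincomb-zero G r))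

  lincomb-∈ : ∀ a → lincomb a G ∈⟨ G ⟩[mod M ]
  lincomb-∈ a = a , ≈-refl

  generator-∈ : ∀ i → G i ∈⟨ G ⟩[mod M ]
  generator-∈ i = (λ j → δ j i) , ≈-reflexive (λ r → sym (lincomb-δ G i r))

  ∈-⊕ : {x y : Vecℤ n} → x ∈⟨ G ⟩[mod M ] → y ∈⟨ G ⟩[mod M ] → x ⊕ y ∈⟨ G ⟩[mod M ]
  ∈-⊕ (a , x≈) (b , y≈) =
    (λ i → a i + b i) , ≈-trans (≈-⊕ x≈ y≈) (≈-reflexive (λ r → sym (lincomb-⊕ G a b r)))

  ∈-⊛ : ∀ c {x : Vecℤ n} → x ∈⟨ G ⟩[mod M ] → c ⊛ x ∈⟨ G ⟩[mod M ]
  ∈-⊛ c (a , x≈) =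
    (λ i → c * a i) , ≈-trans (≈-⊛ c x≈) (≈-reflexive (λ r → sym (lincomb-⊛ G c a r)))

  modulus-∈ : (w : Vecℤ n) → M ⊛ w ∈⟨ G ⟩[mod M ]
  modulus-∈ w = ∈-resp-≈ (⊛-≈-0 w) 0ᵥ-∈

  ∈-sumF : ∀ {l} (H : Fin l → Vecℤ n) → (∀ j → H j ∈⟨ G ⟩[mod M ]) →
           (λ r → sumF (λ j → H j r)) ∈⟨ G ⟩[mod M ]
  ∈-sumF {zero}  H H∈ = 0ᵥ-∈
  ∈-sumF {suc l} H H∈ = ∈-⊕ (H∈ F.zero) (∈-sumF (H ∘ F.suc) (H∈ ∘ F.suc))

  ∈-lincomb : ∀ {l} (a : Fin l → ℤ) (H : Fin l → Vecℤ n) → (∀ j → H j ∈⟨ G ⟩[mod M ]) →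
              lincomb a H ∈⟨ G ⟩[mod M ]
  ∈-lincomb a H H∈ = ∈-sumF (λ j → a j ⊛ H j) (λ j → ∈-⊛ (a j) (H∈ j))

  ∈-trans : ∀ {l} {H : Fin l → Vecℤ n} → (∀ j → H j ∈⟨ G ⟩[mod M ]) →
            ∀ {x} → x ∈⟨ H ⟩[mod M ] → x ∈⟨ G ⟩[mod M ]
  ∈-trans {H = H} H∈ (a , x≈) = ∈-resp-≈ x≈ (∈-lincomb a H H∈)

≈⇒⊖-∈ : ∀ {k n M} {G : Fin k → Vecℤ n} {x y} → x ≈ y [mod M ] → x ⊖ y ∈⟨ G ⟩[mod M ]
≈⇒⊖-∈ {M = M} {x = x} {y} (w , eq) = ∈-resp-≗ (λ r → lemma (x r) (y r) M (w r) (eq r)) (modulus-∈ w)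
  where
  lemma : ∀ a b M w → a ≡ b + M * w → a - b ≡ M * w
  lemma a b M w a≡ = trans (cong (_- b) a≡) (cancel b M w)
    where
    cancel : ∀ b M w → (b + M * w) - b ≡ M * w
    cancel = solve-∀

module _ {n : ℕ} (d : Vecℤ n) where

  diagonal : Fin n → Vecℤ n
  diagonal t = d t ⊛ e t

  lincomb-diagonal : ∀ a → lincomb a diagonal ≗ λ t → a t * d t
  lincomb-diagonal a t = trans (sumF-cong (λ i → sym (ℤ.*-assoc (a i) (d i) (δ i t))))
                               (sumF-δ (λ i → a i * d i) t)

  ∈-diagonal⇒∣ : ∀ {N z} → (∀ t → d t ∣ₛ N) → z ∈⟨ diagonal ⟩[mod N ] → ∀ t → d t ∣ₛ z t
  ∈-diagonal⇒∣ {N} {z} d∣N (a , (w , eq)) t with d∣N t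
  ... | divides q N≡qd = divides (a t + q * w t) (begin
    z t                              ≡⟨ eq t ⟩
    lincomb a diagonal t + N * w t   ≡⟨ cong₂ (λ u v → u + v * w t) (lincomb-diagonal a t) N≡qd ⟩
    a t * d t + (q * d t) * w t      ≡⟨ lemma (a t) (d t) q (w t) ⟩
    (a t + q * w t) * d t            ∎)
    where
    open ≡-Reasoning
    lemma : ∀ a d q w → a * d + (q * d) * w ≡ (a + q * w) * d
    lemma = solve-∀

  ∣⇒∈-diagonal : ∀ {N z} → (∀ t → d t ∣ₛ z t) → z ∈⟨ diagonal ⟩[mod N ]
  ∣⇒∈-diagonal {z = z} d∣z =
    quotients , ≈-reflexive λ t → trans (equality t) (sym (lincomb-diagonal quotients t))
    where
    quotients : Vecℤ n
    quotients t with d∣z t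
    ... | divides q _ = q
    equality : ∀ t → z t ≡ quotients t * d t
    equality t with d∣z t
    ... | divides q zₜ≡qd = zₜ≡qd

-- Linear maps and automorphisms modulo N

record LinearMap (n : ℕ) : Set where
  field
    apply   : Vecℤ n → Vecℤ n
    apply-cong : ∀ {x y} → x ≗ y → apply x ≗ apply y
    apply-⊕ : ∀ x y → apply (x ⊕ y) ≗ apply x ⊕ apply y
    apply-⊛ : ∀ c x → apply (c ⊛ x) ≗ c ⊛ apply x
open LinearMap public

module _ {n : ℕ} (f : LinearMap n) where

  apply-0ᵥ : apply f 0ᵥ ≗ 0ᵥ
  apply-0ᵥ = apply-⊛ f 0ℤ 0ᵥ

  apply-lincomb : ∀ {k} (a : Fin k → ℤ) (G : Fin k → Vecℤ n) →
                  apply f (lincomb a G) ≗ lincomb a (apply f ∘ G)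
  apply-lincomb {zero}  a G r = apply-0ᵥ r
  apply-lincomb {suc k} a G r = begin
    apply f ((a₀ ⊛ G F.zero) ⊕ lincomb (a ∘ F.suc) (G ∘ F.suc)) r
      ≡⟨ apply-⊕ f (a₀ ⊛ G F.zero) _ r ⟩
    apply f (a₀ ⊛ G F.zero) r + apply f (lincomb (a ∘ F.suc) (G ∘ F.suc)) r
      ≡⟨ cong₂ _+_ (apply-⊛ f a₀ (G F.zero) r) (apply-lincomb (a ∘ F.suc) (G ∘ F.suc) r) ⟩
    a₀ * apply f (G F.zero) r + lincomb (a ∘ F.suc) (apply f ∘ G ∘ F.suc) r ∎
    where
    open ≡-Reasoning
    a₀ = a F.zero

  apply-⊖ : ∀ x y → apply f (x ⊖ y) ≗ apply f x ⊖ apply f y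
  apply-⊖ x y r = begin
    apply f (x ⊖ y) r                  ≡⟨ apply-cong f (λ s → lemma (x s) (y s)) r ⟩
    apply f (x ⊕ (- 1ℤ ⊛ y)) r          ≡⟨ apply-⊕ f x _ r ⟩
    apply f x r + apply f (- 1ℤ ⊛ y) r ≡⟨ cong (_+_ (apply f x r)) (apply-⊛ f (- 1ℤ) y r) ⟩
    apply f x r + - 1ℤ * apply f y r   ≡⟨ lemma (apply f x r) (apply f y r) ⟨
    apply f x r - apply f y r          ∎
    where
    open ≡-Reasoning
    lemma : ∀ a b → a - b ≡ a + - 1ℤ * b
    lemma = solve-∀

  apply-≈ : ∀ {M x y} → x ≈ y [mod M ] → apply f x ≈ apply f y [mod M ]
  apply-≈ {M} {y = y} (w , eq) = apply f w , λ r →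
    trans (apply-cong f eq r)
          (trans (apply-⊕ f y (M ⊛ w) r) (cong (_+_ (apply f y r)) (apply-⊛ f M w r)))

  apply-∈ : ∀ {k M x} {G : Fin k → Vecℤ n} → x ∈⟨ G ⟩[mod M ] → apply f x ∈⟨ apply f ∘ G ⟩[mod M ]
  apply-∈ {G = G} (a , x≈) = a , ≈-trans (apply-≈ x≈) (≈-reflexive (apply-lincomb a G))

idₗ : ∀ {n} → LinearMap n
idₗ = record
  { apply = λ x → x ; apply-cong = λ x≗y → x≗y ; apply-⊕ = λ _ _ _ → refl ; apply-⊛ = λ _ _ _ → refl }

_∘ₗ_ : ∀ {n} → LinearMap n → LinearMap n → LinearMap n
g ∘ₗ f = record
  { apply      = apply g ∘ apply f
  ; apply-cong = apply-cong g ∘ apply-cong f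
  ; apply-⊕    = λ x y r → trans (apply-cong g (apply-⊕ f x y) r) (apply-⊕ g (apply f x) (apply f y) r)
  ; apply-⊛    = λ c x r → trans (apply-cong g (apply-⊛ f c x) r) (apply-⊛ g c (apply f x) r)
  }

record Automorphism (n : ℕ) (N : ℤ) : Set where
  field
    to from : LinearMap n
    from∘to : ∀ x → apply from (apply to x) ≈ x [mod N ]
    to∘from : ∀ x → apply to (apply from x) ≈ x [mod N ]
open Automorphism public

idₐ : ∀ {n N} → Automorphism n N
idₐ = record { to = idₗ ; from = idₗ ; from∘to = λ _ → ≈-refl ; to∘from = λ _ → ≈-refl }

_∘ₐ_ : ∀ {n N} → Automorphism n N → Automorphism n N → Automorphism n N
B ∘ₐ A = record
  { to      = to B ∘ₗ to A
  ; from    = from A ∘ₗ from B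
  ; from∘to = λ x → ≈-trans (apply-≈ (from A) (from∘to B (apply (to A) x))) (from∘to A x)
  ; to∘from = λ x → ≈-trans (apply-≈ (to B) (to∘from A (apply (from B) x))) (to∘from B x)
  }

module _ {n N} (A : Automorphism n N) {k} {G H : Fin k → Vecℤ n}
         (G↦H : ∀ i → apply (to A) (G i) ≈ H i [mod N ]) where

  ∈-to : ∀ {x} → x ∈⟨ G ⟩[mod N ] → apply (to A) x ∈⟨ H ⟩[mod N ]
  ∈-to x∈ = ∈-trans (λ i → ∈-resp-≈ (G↦H i) (generator-∈ i)) (apply-∈ (to A) x∈)

  ∈-from : ∀ {x} → apply (to A) x ∈⟨ H ⟩[mod N ] → x ∈⟨ G ⟩[mod N ]
  ∈-from {x} Ax∈ = ∈-resp-≈ (≈-sym (from∘to A x))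
    (∈-trans (λ i → ∈-resp-≈ (H↦G i) (generator-∈ i)) (apply-∈ (from A) Ax∈))
    where
    H↦G : ∀ i → apply (from A) (H i) ≈ G i [mod N ]
    H↦G i = ≈-trans (apply-≈ (from A) (≈-sym (G↦H i))) (from∘to A (G i))

shear : ∀ {n} → Fin n → Vecℤ n → LinearMap n
shear k v = record
  { apply      = λ x → x ⊕ (x k ⊛ v)
  ; apply-cong = λ x≗y r → cong₂ _+_ (x≗y r) (cong (_* v r) (x≗y k))
  ; apply-⊕    = λ x y r → ⊕-lemma (x r) (y r) (x k) (y k) (v r)
  ; apply-⊛    = λ c x r → ⊛-lemma c (x r) (x k) (v r)
  }
  where
  ⊕-lemma : ∀ a b aₖ bₖ c → (a + b) + (aₖ + bₖ) * c ≡ (a + aₖ * c) + (b + bₖ * c)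
  ⊕-lemma = solve-∀
  ⊛-lemma : ∀ d a aₖ c → d * a + (d * aₖ) * c ≡ d * (a + aₖ * c)
  ⊛-lemma = solve-∀

module _ {n : ℕ} (k : Fin n) where

  shear-∘ : ∀ v w x →
    apply (shear k w) (apply (shear k v) x) ≗ apply (shear k (v ⊕ ((1ℤ + v k) ⊛ w))) x
  shear-∘ v w x r = lemma (x r) (x k) (v r) (v k) (w r)
    where
    lemma : ∀ a aₖ b bₖ c → (a + aₖ * b) + (aₖ + aₖ * bₖ) * c ≡ a + aₖ * (b + (1ℤ + bₖ) * c)
    lemma = solve-∀

  shear-≈-id : ∀ {N v} → v ≈ 0ᵥ [mod N ] → ∀ x → apply (shear k v) x ≈ x [mod N ]
  shear-≈-id {N} (q , v≡Nq) x = (λ r → x k * q r) , λ r →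
    trans (cong (λ z → x r + x k * z) (v≡Nq r)) (lemma (x r) (x k) N (q r))
    where
    lemma : ∀ a aₖ N q → a + aₖ * (0ℤ + N * q) ≡ a + N * (aₖ * q)
    lemma = solve-∀

  shear-fixes : ∀ v {x} → x k ≡ 0ℤ → apply (shear k v) x ≗ x
  shear-fixes v {x} xₖ≡0 r = begin
    x r + x k * v r ≡⟨ cong (λ z → x r + z * v r) xₖ≡0 ⟩
    x r + 0ℤ * v r  ≡⟨ cong (_+_ (x r)) (ℤ.*-zeroˡ (v r)) ⟩
    x r + 0ℤ        ≡⟨ ℤ.+-identityʳ (x r) ⟩
    x r             ∎
    where open ≡-Reasoning

  shear-fixes-e : ∀ v {s} → s ≢ k → apply (shear k v) (e s) ≗ e s
  shear-fixes-e v s≢k = shear-fixes v (δ-offdiag s≢k)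

  shearAutomorphism : ∀ {N} (v w : Vecℤ n) →
    v ⊕ ((1ℤ + v k) ⊛ w) ≈ 0ᵥ [mod N ] → w ⊕ ((1ℤ + w k) ⊛ v) ≈ 0ᵥ [mod N ] → Automorphism n N
  shearAutomorphism v w vw≈0 wv≈0 = record
    { to      = shear k v
    ; from    = shear k w
    ; from∘to = λ x → ≈-trans (≈-reflexive (shear-∘ v w x)) (shear-≈-id vw≈0 x)
    ; to∘from = λ x → ≈-trans (≈-reflexive (shear-∘ w v x)) (shear-≈-id wv≈0 x)
    }

  transvection : ∀ {N} (c : Vecℤ n) → c k ≡ 0ℤ → Automorphism n N
  transvection c cₖ≡0 = shearAutomorphism c (λ r → - c r)
    (≈-reflexive λ r → trans (cong (λ z → c r + (1ℤ + z) * - c r) cₖ≡0) (lemma (c r)))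
    (≈-reflexive λ r → trans (cong (λ z → - c r + (1ℤ + - z) * c r) cₖ≡0) (lemma′ (c r)))
    where
    lemma : ∀ a → a + (1ℤ + 0ℤ) * - a ≡ 0ℤ
    lemma = solve-∀
    lemma′ : ∀ a → - a + (1ℤ + - 0ℤ) * a ≡ 0ℤ
    lemma′ = solve-∀

  -- Since l u_k ≡ 1 (mod N), the shears by l (e_k − u) and by u − e_k are mutually inverse
  -- modulo N, and the latter sends e_k to u.
  pivotAutomorphism : ∀ {N} (u : Vecℤ n) (l q : ℤ) → l * u k ≡ 1ℤ + N * q →
    Σ (Automorphism n N) λ A →
      (∀ {s} → s ≢ k → apply (to A) (e s) ≗ e s) × apply (to A) u ≈ e k [mod N ]
  pivotAutomorphism {N} u l q lu≡1 =
    shearAutomorphism v w (residue , v∘w) (residue , w∘v) , shear-fixes-e v , (residue , pivot)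
    where
    open ≡-Reasoning
    v w residue : Vecℤ n
    v = l ⊛ (e k ⊖ u)
    w = u ⊖ e k
    residue r = q * (δ k r - u r)

    vanishes : ∀ r → (1ℤ - l * u k) * (u r - δ k r) ≡ 0ℤ + N * residue r
    vanishes r = begin
      (1ℤ - l * u k) * (u r - δ k r)         ≡⟨ cong (λ z → (1ℤ - z) * (u r - δ k r)) lu≡1 ⟩
      (1ℤ - (1ℤ + N * q)) * (u r - δ k r)    ≡⟨ lemma (u r) (δ k r) N q ⟩
      0ℤ + N * residue r                     ∎
      where
      lemma : ∀ a d N q → (1ℤ - (1ℤ + N * q)) * (a - d) ≡ 0ℤ + N * (q * (d - a))
      lemma = solve-∀

    v∘w : ∀ r → (v ⊕ ((1ℤ + v k) ⊛ w)) r ≡ 0ℤ + N * residue r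
    v∘w r = begin
      l * (δ k r - u r) + (1ℤ + l * (δ k k - u k)) * (u r - δ k r)
        ≡⟨ cong (λ z → l * (δ k r - u r) + (1ℤ + l * (z - u k)) * (u r - δ k r)) (δ-diag k) ⟩
      l * (δ k r - u r) + (1ℤ + l * (1ℤ - u k)) * (u r - δ k r)
        ≡⟨ lemma l (u k) (u r) (δ k r) ⟩
      (1ℤ - l * u k) * (u r - δ k r)
        ≡⟨ vanishes r ⟩
      0ℤ + N * residue r ∎
      where
      lemma : ∀ l uₖ a d → l * (d - a) + (1ℤ + l * (1ℤ - uₖ)) * (a - d) ≡ (1ℤ - l * uₖ) * (a - d)
      lemma = solve-∀

    w∘v : ∀ r → (w ⊕ ((1ℤ + w k) ⊛ v)) r ≡ 0ℤ + N * residue r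
    w∘v r = begin
      (u r - δ k r) + (1ℤ + (u k - δ k k)) * (l * (δ k r - u r))
        ≡⟨ cong (λ z → (u r - δ k r) + (1ℤ + (u k - z)) * (l * (δ k r - u r))) (δ-diag k) ⟩
      (u r - δ k r) + (1ℤ + (u k - 1ℤ)) * (l * (δ k r - u r))
        ≡⟨ lemma l (u k) (u r) (δ k r) ⟩
      (1ℤ - l * u k) * (u r - δ k r)
        ≡⟨ vanishes r ⟩
      0ℤ + N * residue r ∎
      where
      lemma : ∀ l uₖ a d → (a - d) + (1ℤ + (uₖ - 1ℤ)) * (l * (d - a)) ≡ (1ℤ - l * uₖ) * (a - d)
      lemma = solve-∀

    pivot : ∀ r → u r + u k * v r ≡ e k r + N * residue r
    pivot r = begin
      u r + u k * (l * (δ k r - u r))     ≡⟨ lemma (u r) (u k) l (δ k r) ⟩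
      u r + (l * u k) * (δ k r - u r)     ≡⟨ cong (λ z → u r + z * (δ k r - u r)) lu≡1 ⟩
      u r + (1ℤ + N * q) * (δ k r - u r)  ≡⟨ lemma′ (u r) N q (δ k r) ⟩
      δ k r + N * residue r               ∎
      where
      lemma : ∀ a aₖ l d → a + aₖ * (l * (d - a)) ≡ a + (l * aₖ) * (d - a)
      lemma = solve-∀
      lemma′ : ∀ a N q d → a + (1ℤ + N * q) * (d - a) ≡ d + N * (q * (d - a))
      lemma′ = solve-∀

-- Units modulo a prime power

coprime-* : ∀ {a b c} → Coprime a b → Coprime a c → Coprime a (b ℕ.* c)
coprime-* {b = b} a⊥b a⊥c (d∣a , d∣bc) = a⊥c (d∣a , coprime-divisor d⊥b d∣bc)
  where
  d⊥b : Coprime _ b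
  d⊥b (f∣d , f∣b) = a⊥b (∣-trans f∣d d∣a , f∣b)

coprime-^ : ∀ {a b} → Coprime a b → ∀ m → Coprime a (b ℕ.^ m)
coprime-^ a⊥b zero    (_ , d∣1) = ∣1⇒≡1 d∣1
coprime-^ a⊥b (suc m) = coprime-* a⊥b (coprime-^ a⊥b m)

inverse-mod : ∀ {k M} → Coprime k M → ∃₂ λ l q → l * + k ≡ 1ℤ + + M * q
inverse-mod {k} {M} k⊥M = fromIdentity (coprime-Bézout k⊥M)
  where
  open ≡-Reasoning
  toℤ : ∀ a b c d → 1 ℕ.+ a ℕ.* b ≡ c ℕ.* d → 1ℤ + + a * + b ≡ + c * + d
  toℤ a b c d eq = trans (cong (_+_ 1ℤ) (sym (ℤ.pos-* a b))) (trans (cong +_ eq) (ℤ.pos-* c d))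
  lemma : ∀ x k → - x * k ≡ 1ℤ + - (1ℤ + x * k)
  lemma = solve-∀
  lemma′ : ∀ y M → 1ℤ + - (y * M) ≡ 1ℤ + M * - y
  lemma′ = solve-∀
  fromIdentity : Bézout.Identity 1 k M → ∃₂ λ l q → l * + k ≡ 1ℤ + + M * q
  fromIdentity (Bézout.+- x y eq) =
    + x , + y , trans (sym (toℤ y M x k eq)) (cong (_+_ 1ℤ) (ℤ.*-comm (+ y) (+ M)))
  fromIdentity (Bézout.-+ x y eq) = - (+ x) , - (+ y) , (begin
    - (+ x) * + k              ≡⟨ lemma (+ x) (+ k) ⟩
    1ℤ + - (1ℤ + + x * + k)    ≡⟨ cong (λ z → 1ℤ + - z) (toℤ x k y M eq) ⟩
    1ℤ + - (+ y * + M)         ≡⟨ lemma′ (+ y) (+ M) ⟩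
    1ℤ + + M * - (+ y)         ∎)

invertible-mod-prime-power : ∀ {p} → Prime p → ∀ m {u} → ¬ (+ p ∣ₛ u) →
                             ∃₂ λ l q → l * u ≡ 1ℤ + + (p ℕ.^ m) * q
invertible-mod-prime-power {p} p-prime m {u} p∤u = invert u (coprime-^ ∣u∣⊥p m)
  where
  ∣u∣⊥p : Coprime ℤ.∣ u ∣ p
  ∣u∣⊥p (d∣u , d∣p) with prime⇒irreducible p-prime d∣p
  ... | inj₁ d≡1  = d≡1
  ... | inj₂ refl = ⊥-elim (p∤u (∣ᵤ⇒∣ d∣u))

  invert : ∀ u → Coprime ℤ.∣ u ∣ (p ℕ.^ m) → ∃₂ λ l q → l * u ≡ 1ℤ + + (p ℕ.^ m) * q
  invert (+ k)    k⊥pᵐ = inverse-mod k⊥pᵐ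
  invert -[1+ k ] k⊥pᵐ with inverse-mod k⊥pᵐ
  ... | l , q , lk≡1 = - l , q , trans (lemma l (+ suc k)) lk≡1
    where
    lemma : ∀ l k → - l * - k ≡ l * k
    lemma = solve-∀

-- Gaussian elimination modulo N

truncate : ∀ {n} → ℕ → Vecℤ n → Vecℤ n
truncate t u i with toℕ i ℕ.<? t
... | yes _ = u i
... | no  _ = 0ℤ

truncate-vanishes : ∀ {n t} (u : Vecℤ n) {i} → t ℕ.≤ toℕ i → truncate t u i ≡ 0ℤ
truncate-vanishes {t = t} u {i} t≤i with toℕ i ℕ.<? t
... | yes i<t = ⊥-elim (ℕ.<⇒≱ i<t t≤i)
... | no  _   = refl

truncate-≈ : ∀ {n t M} (u : Vecℤ n) → (∀ r → t ℕ.≤ toℕ r → M ∣ₛ u r) → u ≈ truncate t u [mod M ]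
truncate-≈ {t = t} {M} u M∣u = pointwise-≈ coordinate
  where
  coordinate : ∀ r → ∃ λ q → u r ≡ truncate t u r + M * q
  coordinate r with toℕ r ℕ.<? t
  ... | yes _ = 0ℤ , lemma (u r) M
    where
    lemma : ∀ a M → a ≡ a + M * 0ℤ
    lemma = solve-∀
  ... | no r≮t with M∣u r (ℕ.≮⇒≥ r≮t)
  ...   | divides q uᵣ≡qM = q , trans uᵣ≡qM (lemma q M)
    where
    lemma : ∀ q M → q * M ≡ 0ℤ + M * q
    lemma = solve-∀

module Elimination {n : ℕ} (p : ℕ) {N : ℤ} (p∣N : + p ∣ₛ N)
  (invertible : ∀ {u} → ¬ (+ p ∣ₛ u) → ∃₂ λ l q → l * u ≡ 1ℤ + N * q)
  (y : Fin n → Vecℤ n) (Good : Fin n → Set) (good? : ∀ t → Dec (Good t))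
  (good-↓ : ∀ {s t} → s F.≤ t → Good t → Good s)
  (independent : ∀ {t} → Good t → ∀ a → (∀ i → t F.≤ i → a i ≡ 0ℤ) →
                 ¬ (y t ≈ lincomb a y [mod + p ]))
  where

  Reduces : Automorphism n N → ℕ → Set
  Reduces A t = ∀ s → toℕ s ℕ.< t → Good s → apply (to A) (y s) ≈ e s [mod N ]

  Fixes : Automorphism n N → Fin n → Set
  Fixes B t = ∀ s → s F.< t → apply (to B) (e s) ≗ e s

  dependent : ∀ {t} (A : Automorphism n N) → Reduces A (toℕ t) → Good t →
              let u = apply (to A) (y t) in
              (∀ r → t F.≤ r → + p ∣ₛ u r) → y t ≈ lincomb (truncate (toℕ t) u) y [mod + p ]
  dependent {t} A reduces good p∣u =
    ≈-trans (≈-weaken p∣N (≈-sym (from∘to A (y t))))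
    (≈-trans (apply-≈ (from A) u≈a)
    (≈-trans (≈-reflexive (apply-lincomb (from A) a e))
             (≈-weaken p∣N (lincomb-≈ a termwise))))
    where
    u = apply (to A) (y t)
    a = truncate (toℕ t) u
    u≈a : u ≈ lincomb a e [mod + p ]
    u≈a = ≈-trans (truncate-≈ u p∣u) (≈-reflexive (λ r → sym (lincomb-e a r)))
    termwise : ∀ i → a i ⊛ apply (from A) (e i) ≈ a i ⊛ y i [mod N ]
    termwise i = byCases (i F.<? t)
      where
      byCases : Dec (i F.< t) → a i ⊛ apply (from A) (e i) ≈ a i ⊛ y i [mod N ]
      byCases (yes i<t) = ≈-⊛ (a i) (≈-trans
        (apply-≈ (from A) (≈-sym (reduces i i<t (good-↓ (ℕ.<⇒≤ i<t) good)))) (from∘to A (y i)))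
      byCases (no i≮t)  = ≈-reflexive (zero-⊛ (truncate-vanishes u (ℕ.≮⇒≥ i≮t)) _ (y i))

  pivotCoordinate : ∀ {t} (A : Automorphism n N) → Reduces A (toℕ t) → Good t →
                    ∃ λ r → t F.≤ r × ¬ (+ p ∣ₛ apply (to A) (y t) r)
  pivotCoordinate {t} A reduces good
    with any? (λ r → (t F.≤? r) ×-dec ¬? (+ p ∣ₛ? apply (to A) (y t) r))
  ... | yes found = found
  ... | no  none  =
    ⊥-elim (independent good _ (λ i → truncate-vanishes _) (dependent A reduces good p∣u))
    where
    p∣u : ∀ r → t F.≤ r → + p ∣ₛ apply (to A) (y t) r
    p∣u r t≤r = decidable-stable (+ p ∣ₛ? _) (λ p∤ → none (r , t≤r , p∤))

  -- If p ∣ u_t, the transvection adding coordinate r to coordinate t makes that entry u_t + u_r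
  -- prime to p.
  unitAtPivot : ∀ {t r} (u : Vecℤ n) → t F.≤ r → ¬ (+ p ∣ₛ u r) →
                ∃ λ T → Fixes T t × ¬ (+ p ∣ₛ apply (to T) u t)
  unitAtPivot {t} {r} u t≤r p∤uᵣ with + p ∣ₛ? u t
  ... | no  p∤uₜ = idₐ , (λ _ _ _ → refl) , p∤uₜ
  ... | yes p∣uₜ = transvection r (e t) (δ-offdiag t≢r) , fixes , p∤
    where
    t≢r : t ≢ r
    t≢r refl = p∤uᵣ p∣uₜ
    fixes : ∀ s → s F.< t → apply (shear r (e t)) (e s) ≗ e s
    fixes s s<t = shear-fixes-e r (e t) (<⇒≢ (ℕ.<-≤-trans s<t t≤r))
    p∤ : ¬ (+ p ∣ₛ u t + u r * δ t t)
    p∤ p∣ = p∤uᵣ (subst (+ p ∣ₛ_) (trans (cong (u r *_) (δ-diag t)) (ℤ.*-identityʳ (u r)))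
                                   (∣m+n∣m⇒∣n p∣ p∣uₜ))

  normalise : ∀ {t r} (u : Vecℤ n) → t F.≤ r → ¬ (+ p ∣ₛ u r) →
              ∃ λ B → Fixes B t × apply (to B) u ≈ e t [mod N ]
  normalise {t} u t≤r p∤uᵣ =
    let T , T-fixes , p∤   = unitAtPivot u t≤r p∤uᵣ
        l , q , lu≡1       = invertible p∤
        P , P-fixes , maps = pivotAutomorphism t (apply (to T) u) l q lu≡1
    in P ∘ₐ T
     , (λ s s<t r → trans (apply-cong (to P) (T-fixes s s<t) r) (P-fixes (<⇒≢ s<t) r))
     , maps

  extend : ∀ {t} (A : Automorphism n N) → Reduces A (toℕ t) → Good t →
           ∃ λ A′ → Reduces A′ (toℕ t) × apply (to A′) (y t) ≈ e t [mod N ]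
  extend {t} A reduces good =
    let r , t≤r , p∤      = pivotCoordinate A reduces good
        B , fixes , maps  = normalise (apply (to A) (y t)) t≤r p∤
    in B ∘ₐ A
     , (λ s s<t good-s → ≈-trans (apply-≈ (to B) (reduces s s<t good-s)) (≈-reflexive (fixes s s<t)))
     , maps

  Reducible : ℕ → Set
  Reducible t = ∃ λ A → Reduces A t

  reduces-suc : ∀ {A t} → Reduces A (toℕ t) → (Good t → apply (to A) (y t) ≈ e t [mod N ]) →
                Reduces A (suc (toℕ t))
  reduces-suc reduces reduces-t s s<1+t good with ℕ.m<1+n⇒m<n∨m≡n s<1+t
  ... | inj₁ s<t = reduces s s<t good
  ... | inj₂ s≡t with toℕ-injective s≡t
  ...   | refl = reduces-t good

  eliminate-step : ∀ t → Reducible (toℕ t) → Reducible (suc (toℕ t))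
  eliminate-step t (A , reduces) with good? t
  ... | no ¬good = A , reduces-suc {A} reduces (⊥-elim ∘ ¬good)
  ... | yes good = let A′ , reduces′ , maps = extend A reduces good
                   in A′ , reduces-suc {A′} reduces′ (λ _ → maps)

  eliminate : ∀ t → t ℕ.≤ n → Reducible t
  eliminate zero    _   = idₐ , λ _ ()
  eliminate (suc t) t<n = subst (Reducible ∘ suc) (toℕ-fromℕ< t<n)
    (eliminate-step (F.fromℕ< t<n)
      (subst Reducible (sym (toℕ-fromℕ< t<n)) (eliminate t (ℕ.<⇒≤ t<n))))

  reduction : ∃ λ A → ∀ s → Good s → apply (to A) (y s) ≈ e s [mod N ]
  reduction with eliminate n ℕ.≤-refl
  ... | A , reduces = A , λ s → reduces s (toℕ<n s)

-- Krylov vectors and the invariants Λ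

matrix : ∀ {n} → Matℤ n → LinearMap n
matrix X = record
  { apply      = X ·_
  ; apply-cong = λ x≗y r → sumF-cong (λ k → cong (X r k *_) (x≗y k))
  ; apply-⊕    = λ x y r → trans (sumF-cong (λ k → ℤ.*-distribˡ-+ (X r k) (x k) (y k)))
                                 (sumF-+ (λ k → X r k * x k) (λ k → X r k * y k))
  ; apply-⊛    = λ c x r → trans (sumF-cong (λ k → lemma (X r k) c (x k)))
                                 (sym (*-distribˡ-sumF c (λ k → X r k * x k)))
  }
  where
  lemma : ∀ a c x → a * (c * x) ≡ c * (a * x)
  lemma = solve-∀

module Krylov {n : ℕ} (X : Matℤ n) (b : Vecℤ n) where

  krylov : (k : ℕ) → Fin k → Vecℤ n
  krylov k i = powApp X (toℕ i) b

  power-∈ : ∀ {k K M} → k ℕ.< K → powApp X k b ∈⟨ krylov K ⟩[mod M ]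
  power-∈ {k} {K} {M} k<K =
    subst (λ i → powApp X i b ∈⟨ krylov K ⟩[mod M ]) (toℕ-fromℕ< k<K) (generator-∈ (F.fromℕ< k<K))

  krylov-suc : ∀ {k M} → powApp X k b ∈⟨ krylov k ⟩[mod M ] →
               powApp X (suc k) b ∈⟨ krylov (suc k) ⟩[mod M ]
  krylov-suc X^kb∈ = ∈-trans (λ i → generator-∈ (F.suc i)) (apply-∈ (matrix X) X^kb∈)

  krylov-+ : ∀ d {k M} → powApp X k b ∈⟨ krylov k ⟩[mod M ] →
             powApp X (d ℕ.+ k) b ∈⟨ krylov (d ℕ.+ k) ⟩[mod M ]
  krylov-+ zero    X^kb∈ = X^kb∈
  krylov-+ (suc d) X^kb∈ = krylov-suc (krylov-+ d X^kb∈)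

  krylov-mono : ∀ {k l M} → k ℕ.≤ l → powApp X k b ∈⟨ krylov k ⟩[mod M ] →
                powApp X l b ∈⟨ krylov l ⟩[mod M ]
  krylov-mono {k} {l} {M} k≤l X^kb∈ =
    subst (λ i → powApp X i b ∈⟨ krylov i ⟩[mod M ]) (ℕ.m∸n+n≡m k≤l) (krylov-+ (l ℕ.∸ k) X^kb∈)

  fromInSpanMod : ∀ {p t j} → InSpanMod p X b t j →
                  powApp X (toℕ t) b ∈⟨ krylov (toℕ t) ⟩[mod + (p ℕ.^ j) ]
  fromInSpanMod (c , w , eq) = c , (w , eq)

  toInSpanMod : ∀ {p t j} → powApp X (toℕ t) b ∈⟨ krylov (toℕ t) ⟩[mod + (p ℕ.^ j) ] →
                InSpanMod p X b t j
  toInSpanMod (c , (w , eq)) = c , w , eq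

module Invariants {n : ℕ} (p m : ℕ) (X : Matℤ n) (b : Vecℤ n) (Λ : Fin n → ℕ)
                  (isΛ : IsLambda p m X b Λ) where
  open Krylov X b

  p^_ : ℕ → ℤ
  p^ j = + (p ℕ.^ j)

  p^-suc : ∀ j → p^ suc j ≡ p^ j * + p
  p^-suc j = trans (ℤ.pos-* p (p ℕ.^ j)) (ℤ.*-comm (+ p) (p^ j))

  p^-split : ∀ {i j} → i ℕ.≤ j → p^ j ≡ p^ (j ℕ.∸ i) * p^ i
  p^-split {i} {j} i≤j = trans (cong p^_ (sym (ℕ.m∸n+n≡m i≤j)))
    (trans (cong +_ (ℕ.^-distribˡ-+-* p (j ℕ.∸ i) i)) (ℤ.pos-* (p ℕ.^ (j ℕ.∸ i)) (p ℕ.^ i)))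

  Λ≤m : ∀ t → Λ t ℕ.≤ m
  Λ≤m t = proj₁ (isΛ t)

  maximal : ∀ t j → j ℕ.≤ m → InSpanMod p X b t j → j ℕ.≤ Λ t
  maximal t = proj₂ (proj₂ (isΛ t))

  spans : ∀ t → InSpanMod p X b t (Λ t)
  spans t = proj₁ (proj₂ (isΛ t))

  coefficients : ∀ t → Fin (toℕ t) → ℤ
  coefficients t = proj₁ (spans t)

  y Y : Fin n → Vecℤ n
  y t = proj₁ (proj₂ (spans t))
  Y t = p^ Λ t ⊛ y t

  decomposition : ∀ t → powApp X (toℕ t) b ≗ lincomb (coefficients t) (krylov (toℕ t)) ⊕ Y t
  decomposition t = proj₂ (proj₂ (spans t))

  Λ-mono : ∀ {s t} → s F.≤ t → Λ s ℕ.≤ Λ t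
  Λ-mono {s} {t} s≤t = maximal t (Λ s) (Λ≤m s)
    (toInSpanMod {p} {j = Λ s} (krylov-mono s≤t (fromInSpanMod {p} {j = Λ s} (spans s))))

  Y-∈ : ∀ {K M} t → toℕ t ℕ.< K → Y t ∈⟨ krylov K ⟩[mod M ]
  Y-∈ t t<K = ∈-resp-≗ Yₜ≗
    (∈-⊕ (power-∈ t<K) (∈-⊛ (- 1ℤ) (∈-lincomb (coefficients t) (krylov (toℕ t))
                                               (λ j → power-∈ (ℕ.<-trans (toℕ<n j) t<K)))))
    where
    L = lincomb (coefficients t) (krylov (toℕ t))
    Yₜ≗ : Y t ≗ powApp X (toℕ t) b ⊕ (- 1ℤ ⊛ L)
    Yₜ≗ r = trans (lemma (L r) (Y t r)) (cong (λ z → z + - 1ℤ * L r) (sym (decomposition t r)))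
      where
      lemma : ∀ l y → y ≡ (l + y) + - 1ℤ * l
      lemma = solve-∀

  power-∈-Y : ∀ {M} k → k ℕ.< n → powApp X k b ∈⟨ Y ⟩[mod M ]
  power-∈-Y {M} = <-rec (λ k → k ℕ.< n → powApp X k b ∈⟨ Y ⟩[mod M ]) step
    where
    step : ∀ k → (∀ {j} → j ℕ.< k → j ℕ.< n → powApp X j b ∈⟨ Y ⟩[mod M ]) →
           k ℕ.< n → powApp X k b ∈⟨ Y ⟩[mod M ]
    step k IH k<n = subst (λ i → powApp X i b ∈⟨ Y ⟩[mod M ]) (toℕ-fromℕ< k<n)
      (∈-resp-≗ (decomposition t)
        (∈-⊕ (∈-lincomb (coefficients t) (krylov (toℕ t)) lower) (generator-∈ t)))
      where
      t = F.fromℕ< k<n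
      lower : ∀ j → krylov (toℕ t) j ∈⟨ Y ⟩[mod M ]
      lower j = IH j<k (ℕ.<-trans j<k k<n)
        where j<k = subst (toℕ j ℕ.<_) (toℕ-fromℕ< k<n) (toℕ<n j)

  -- Multiplying a relation y_t ≡ Σ_{i<t} a_i y_i (mod p) by p^Λ_t puts X^t b into the span of
  -- the lower powers modulo p^(Λ_t + 1), since p^Λ_t y_i is a multiple of Y_i for i < t.
  independent : ∀ {t} → Λ t ℕ.< m → ∀ a → (∀ i → t F.≤ i → a i ≡ 0ℤ) →
                ¬ (y t ≈ lincomb a y [mod + p ])
  independent {t} Λₜ<m a lower yₜ≈ =
    ℕ.<-irrefl refl (maximal t (suc (Λ t)) Λₜ<m (toInSpanMod {p} {j = suc (Λ t)} X^tb-∈))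
    where
    Yₜ≈ : Y t ≈ p^ Λ t ⊛ lincomb a y [mod p^ suc (Λ t) ]
    Yₜ≈ = subst (λ M → Y t ≈ p^ Λ t ⊛ lincomb a y [mod M ]) (sym (p^-suc (Λ t)))
                (≈-⊛-mod (p^ Λ t) {y t} yₜ≈)
    rescale : ∀ {i} → i F.< t → p^ Λ t ⊛ y i ≗ p^ (Λ t ℕ.∸ Λ i) ⊛ Y i
    rescale {i} i<t r = trans (cong (_* y i r) (p^-split (Λ-mono (ℕ.<⇒≤ i<t))))
                              (ℤ.*-assoc (p^ (Λ t ℕ.∸ Λ i)) (p^ Λ i) (y i r))
    term : ∀ i → a i ⊛ (p^ Λ t ⊛ y i) ∈⟨ krylov (toℕ t) ⟩[mod p^ suc (Λ t) ]
    term i with i F.<? t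
    ... | yes i<t = ∈-⊛ (a i) (∈-resp-≗ (rescale i<t) (∈-⊛ (p^ (Λ t ℕ.∸ Λ i)) (Y-∈ i i<t)))
    ... | no  i≮t = ∈-resp-≗ (zero-⊛ (lower i (ℕ.≮⇒≥ i≮t)) _ 0ᵥ) (∈-⊛ (a i) 0ᵥ-∈)
    X^tb-∈ : powApp X (toℕ t) b ∈⟨ krylov (toℕ t) ⟩[mod p^ suc (Λ t) ]
    X^tb-∈ = ∈-resp-≗ (decomposition t) (∈-⊕ (lincomb-∈ (coefficients t))
      (∈-resp-≈ Yₜ≈ (∈-resp-≗ (⊛-lincomb y (p^ Λ t) a)
                                (∈-sumF (λ i → a i ⊛ (p^ Λ t ⊛ y i)) term))))

-- The cokernel

module Cokernel {n : ℕ} (p m′ : ℕ) (p-prime : Prime p) (X : Matℤ n) (b : Vecℤ n) (Λ : Fin n → ℕ)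
                (isΛ : IsLambda p (suc m′) X b Λ) where
  open Krylov X b
  open Invariants p (suc m′) X b Λ isΛ

  m = suc m′
  N = p^ m

  p∣N : + p ∣ₛ N
  p∣N = divides (p^ m′) (p^-suc m′)

  open Elimination p p∣N (invertible-mod-prime-power p-prime m) y (λ t → Λ t ℕ.< m) (λ t → Λ t ℕ.<? m)
                   (λ s≤t → ℕ.≤-<-trans (Λ-mono s≤t)) independent

  A : Automorphism n N
  A = proj₁ reduction

  f : Vecℤ n → Vecℤ n
  f = apply (to A)

  p^Λ : Vecℤ n
  p^Λ t = p^ Λ t

  D : Fin n → Vecℤ n
  D = diagonal p^Λ

  p^Λ∣N : ∀ t → p^ Λ t ∣ₛ N
  p^Λ∣N t = divides (p^ (m ℕ.∸ Λ t)) (p^-split (Λ≤m t))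

  Y↦D : ∀ t → f (Y t) ≈ D t [mod N ]
  Y↦D t = ≈-trans (≈-reflexive (apply-⊛ (to A) (p^ Λ t) (y t))) (scaled (Λ t ℕ.<? m))
    where
    scaled : Dec (Λ t ℕ.< m) → p^ Λ t ⊛ f (y t) ≈ D t [mod N ]
    scaled (yes good) = ≈-⊛ (p^ Λ t) (proj₂ reduction t good)
    scaled (no  bad)  = multiple-≈ (cong p^_ (ℕ.≤-antisym (Λ≤m t) (ℕ.≮⇒≥ bad))) (f (y t)) (e t)

  coker⇒∈ : ∀ {x x′} → CokerEq p m (Wmat X b) x x′ → x ⊖ x′ ∈⟨ krylov n ⟩[mod N ]
  coker⇒∈ (v , w , eq) =
    v , (w , λ r → trans (eq r) (cong (_+ N * w r) (sumF-cong (λ k → ℤ.*-comm _ (v k)))))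

  ∈⇒coker : ∀ {x x′} → x ⊖ x′ ∈⟨ krylov n ⟩[mod N ] → CokerEq p m (Wmat X b) x x′
  ∈⇒coker (v , (w , eq)) =
    v , w , λ r → trans (eq r) (cong (_+ N * w r) (sumF-cong (λ k → ℤ.*-comm (v k) _)))

  krylov⇒Y : ∀ {z} → z ∈⟨ krylov n ⟩[mod N ] → z ∈⟨ Y ⟩[mod N ]
  krylov⇒Y = ∈-trans (λ t → power-∈-Y (toℕ t) (toℕ<n t))

  Y⇒krylov : ∀ {z} → z ∈⟨ Y ⟩[mod N ] → z ∈⟨ krylov n ⟩[mod N ]
  Y⇒krylov = ∈-trans (λ t → Y-∈ t (toℕ<n t))

  coker⇒D : ∀ x x′ → CokerEq p m (Wmat X b) x x′ → f x ⊖ f x′ ∈⟨ D ⟩[mod N ]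
  coker⇒D x x′ x≈x′ =
    ∈-resp-≗ (λ r → sym (apply-⊖ (to A) x x′ r)) (∈-to A Y↦D (krylov⇒Y (coker⇒∈ {x} {x′} x≈x′)))

  D⇒coker : ∀ x x′ → f x ⊖ f x′ ∈⟨ D ⟩[mod N ] → CokerEq p m (Wmat X b) x x′
  D⇒coker x x′ fx-fx′∈ = ∈⇒coker {x} {x′} (Y⇒krylov (∈-from A Y↦D (∈-resp-≗ (apply-⊖ (to A) x x′) fx-fx′∈)))

  D⇒SumEq : ∀ z z′ → z ⊖ z′ ∈⟨ D ⟩[mod N ] → SumEq p Λ z z′
  D⇒SumEq z z′ z-z′∈ t = ∣⇒∣ᵤ (∈-diagonal⇒∣ p^Λ p^Λ∣N z-z′∈ t)

  SumEq⇒D : ∀ z z′ → SumEq p Λ z z′ → z ⊖ z′ ∈⟨ D ⟩[mod N ]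
  SumEq⇒D z z′ z≈z′ = ∣⇒∈-diagonal p^Λ (λ t → ∣ᵤ⇒∣ (z≈z′ t))

  iso : GroupIso (CokerEq p m (Wmat X b)) (SumEq p Λ)
  iso = f , respects , additive , reflects , surjective
    where
    respects : ∀ x x′ → CokerEq p m (Wmat X b) x x′ → SumEq p Λ (f x) (f x′)
    respects x x′ = D⇒SumEq (f x) (f x′) ∘ coker⇒D x x′
    reflects : ∀ x x′ → SumEq p Λ (f x) (f x′) → CokerEq p m (Wmat X b) x x′
    reflects x x′ = D⇒coker x x′ ∘ SumEq⇒D (f x) (f x′)
    additive : ∀ x x′ → SumEq p Λ (f (x ⊕ x′)) (f x ⊕ f x′)
    additive x x′ t = ∣⇒∣ᵤ {p^ Λ t} (divides 0ℤ (ℤ.i≡j⇒i-j≡0 (apply-⊕ (to A) x x′ t)))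
    surjective : ∀ z → Σ (Vecℤ n) λ x → SumEq p Λ (f x) z
    surjective z = apply (from A) z , D⇒SumEq (f (apply (from A) z)) z (≈⇒⊖-∈ (to∘from A z))

corollary2p2 : (p m n : ℕ) → Prime p → m ≥ 1 → n ≥ 1
    → (X : Matℤ n) (b : Vecℤ n) → ¬ (∀ r → (+ p) ∣ b r)
    → (Λ : Fin n → ℕ) → IsLambda p m X b Λ
    → GroupIso (CokerEq p m (Wmat X b)) (SumEq p Λ)
corollary2p2 p (suc m′) n p-prime _ _ X b _ Λ isΛ = Cokernel.iso p m′ p-prime X b Λ isΛ
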